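{- Let $G$ be a simple, weakly connected directed graph with at least one Eulerian trail and fixed source $v_0$, and let $s$ be any state. Then there is a bijection between the Eulerian trails in the remaining graph $G'_s$ and the Eulerian trails in the graph obtained from $G'_s$ by applying Compression Rule 2.
   Context: Source $v_0$: the unique node with $\mathrm{outdeg}(v)=\mathrm{indeg}(v)+1$ if it exists, otherwise an arbitrary fixed node. States are prefixes $P_s$ of Eulerian trails starting at $v_0$; the last node on $P_s$ is $v_0$ if $P_s$ is empty and otherwise the head of its last edge. The remaining graph $G'_s$ is obtained from $G$ by deleting the edges of $P_s$ and removing isolated nodes (after earlier compressions it may contain self-loops). Compression Rule 2: if a node $v$ in $G'_s$ has exactly one self-loop, exactly one other out-edge, and exactly one other in-edge, remove the self-loop; if $v$ is the last node on $P_s$, remove the self-loop only if $v$ has no other in-edge. -}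

module Defs where

open import Data.Nat using (ℕ; suc; _+_)
open import Data.Fin using (Fin; _≟_)
open import Data.List using (List; []; _∷_; _++_; length; filter; allFin; last)
open import Data.List.Membership.Propositional using (_∈_; _∉_)
open import Data.List.Relation.Unary.Unique.Propositional using (Unique)
open import Data.Maybe using (Maybe; just; nothing)
open import Data.Product using (Σ; ∃; _×_; _,_)
open import Data.Sum using (_⊎_)
open import Data.Unit using (⊤)
open import Relation.Nullary using (¬_)
open import Relation.Binary.PropositionalEquality using (_≡_; _≢_)
open import Relation.Binary.Construct.Closure.ReflexiveTransitive using (Star)

-- Self-loops and parallel
-- edges are representable (needed for compressed remaining graphs).
record Digraph : Set where
  field
    n m : ℕ
    src tgt : Fin m → Fin n

open Digraph public

Node : Digraph → Set
Node G = Fin (n G)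

Edge : Digraph → Set
Edge G = Fin (m G)

outdeg indeg : (G : Digraph) → Node G → ℕ
outdeg G v = length (filter (λ e → src G e ≟ v) (allFin (m G)))
indeg  G v = length (filter (λ e → tgt G e ≟ v) (allFin (m G)))

Adj : (G : Digraph) → Node G → Node G → Set
Adj G u w = ∃ λ e → (src G e ≡ u × tgt G e ≡ w) ⊎ (src G e ≡ w × tgt G e ≡ u)

WeaklyConnected : Digraph → Set
WeaklyConnected G = ∀ u w → Star (Adj G) u w

-- An edge subgraph of G (the edges still present), as a predicate on edges.
EdgeSet : Digraph → Set₁
EdgeSet G = Edge G → Set

AllEdges : (G : Digraph) → EdgeSet G
AllEdges G e = ⊤

Walk : (G : Digraph) → Node G → List (Edge G) → Set
Walk G u []       = ⊤
Walk G u (e ∷ es) = (src G e ≡ u) × Walk G (tgt G e) es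

EulerianTrailFrom : (G : Digraph) → EdgeSet G → Node G → List (Edge G) → Set
EulerianTrailFrom G R u t =
  Walk G u t × Unique t × (∀ e → R e → e ∈ t) × (∀ e → e ∈ t → R e)

HasEulerianTrail : Digraph → Set
HasEulerianTrail G = ∃ λ u → ∃ λ t → EulerianTrailFrom G (AllEdges G) u t

IsSource : (G : Digraph) → Node G → Set
IsSource G v0 = (outdeg G v0 ≡ indeg G v0 + 1)
              ⊎ (∀ v → ¬ (outdeg G v ≡ indeg G v + 1))

IsState : (G : Digraph) → Node G → List (Edge G) → Set
IsState G v0 P = ∃ λ t → EulerianTrailFrom G (AllEdges G) v0 t
                       × ∃ λ rest → t ≡ P ++ rest

lastNode : (G : Digraph) → Node G → List (Edge G) → Node G
lastNode G v0 P with last P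
... | nothing = v0
... | just e  = tgt G e

-- remaining graph G'_s: edges of G not on P (isolated nodes are irrelevant
-- for trails, which are edge lists)
Remaining : (G : Digraph) → List (Edge G) → EdgeSet G
Remaining G P e = e ∉ P

ExactlyOne : (G : Digraph) → (Edge G → Set) → Edge G → Set
ExactlyOne G Q a = Q a × (∀ e → Q e → e ≡ a)

Rule2Applies : (G : Digraph) → EdgeSet G → Node G → Node G → Edge G → Set
Rule2Applies G R u v l =
    ExactlyOne G (λ e → R e × src G e ≡ v × tgt G e ≡ v) l
  × (∃ λ a → ExactlyOne G (λ e → R e × src G e ≡ v × tgt G e ≢ v) a)
  × ( (v ≢ u × ∃ λ b → ExactlyOne G (λ e → R e × tgt G e ≡ v × src G e ≢ v) b)
    ⊎ (v ≡ u × (∀ e → ¬ (R e × tgt G e ≡ v × src G e ≢ v))))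

RemoveLoop : (G : Digraph) → EdgeSet G → Edge G → EdgeSet G
RemoveLoop G R l e = R e × e ≢ l

record Bijection {A : Set} (P Q : A → Set) : Set where
  field
    to       : A → A
    from     : A → A
    to-ok    : ∀ x → P x → Q (to x)
    from-ok  : ∀ x → Q x → P (from x)
    from∘to  : ∀ x → P x → from (to x) ≡ x
    to∘from  : ∀ x → Q x → to (from x) ≡ x

{-# OPTIONS --safe #-}
module Submission where

-- Deleting the self-loop l at v from an Eulerian trail is undone by splicing l back in at the
-- trail's first visit to v.  A trail must take l at that visit: leaving v by another edge, it
-- would have to re-enter v through an in-edge from outside, and Rule 2 leaves none to spare
-- (the only one was used to arrive, or, if v is the current node, there is none).  Neither the
-- out-edge condition of Rule 2 nor connectivity, the source or the state play any role.

open import Defs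
open import Data.List using (List; []; _∷_; filter)
open import Data.List.Properties using (filter-all; filter-reject)
open import Data.List.Relation.Unary.Any using (Any; here; there)
open import Data.List.Relation.Unary.All as All using (All)
open import Data.List.Relation.Unary.All.Properties using (¬Any⇒All¬; All¬⇒¬Any)
open import Data.List.Relation.Unary.AllPairs using (_∷_)
open import Data.List.Membership.Propositional using (_∈_; _∉_; lose)
open import Data.List.Membership.Propositional.Properties using (∈-filter⁺; ∈-filter⁻)
open import Data.List.Relation.Unary.Unique.Propositional using (Unique)
import Data.List.Relation.Unary.Unique.Propositional.Properties as Unique
open import Data.Fin using (_≟_)
open import Data.Empty using (⊥-elim)
open import Data.Unit using (tt)
open import Data.Product using (∃; _×_; _,_; proj₁; proj₂)
open import Data.Sum using (_⊎_; inj₁; inj₂)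
open import Function using (_∘_)
open import Relation.Nullary using (¬_; yes; no; ¬?)
open import Relation.Unary using (Decidable)
open import Relation.Binary.PropositionalEquality

module _ {G : Digraph} {v : Node G} where

  enter-before-leave : ∀ {w x e} → Walk G w x → w ≢ v → e ∈ x → src G e ≡ v
                     → ∃ λ f → f ∈ x × tgt G f ≡ v × src G f ≢ v
  enter-before-leave {x = g ∷ gs} (refl , walk) w≢v e∈x se≡v with tgt G g ≟ v
  ... | yes tg≡v = g , here refl , tg≡v , w≢v
  ... | no tg≢v with e∈x
  ...   | here refl = ⊥-elim (w≢v se≡v)
  ...   | there e∈gs =
          let f , f∈gs , rest = enter-before-leave walk tg≢v e∈gs se≡v in f , there f∈gs , rest

module LoopRemoval (G : Digraph) (R : EdgeSet G) (v : Node G) (l : Edge G)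
  (loop : ExactlyOne G (λ e → R e × src G e ≡ v × tgt G e ≡ v) l) where

  Edges : Set
  Edges = List (Edge G)

  Entering : Edge G → Set
  Entering e = R e × tgt G e ≡ v × src G e ≢ v

  AtMostOneEntering : Set
  AtMostOneEntering = ∀ {e f} → Entering e → Entering f → e ≡ f

  InR : Edges → Set
  InR x = ∀ e → e ∈ x → R e

  R-l : R l
  R-l = proj₁ (proj₁ loop)

  src-l : src G l ≡ v
  src-l = proj₁ (proj₂ (proj₁ loop))

  tgt-l : tgt G l ≡ v
  tgt-l = proj₂ (proj₂ (proj₁ loop))

  ≢-loop? : Decidable (_≢ l)
  ≢-loop? e = ¬? (e ≟ l)

  removeLoop : Edges → Edges
  removeLoop = filter ≢-loop?

  spliceLoopAt : Node G → Edges → Edges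
  spliceLoopAt w y with w ≟ v
  ... | yes _ = l ∷ y
  spliceLoopAt w []       | no _ = []
  spliceLoopAt w (e ∷ es) | no _ = e ∷ spliceLoopAt (tgt G e) es

  removeLoop-id : ∀ {x} → l ∉ x → removeLoop x ≡ x
  removeLoop-id {x} l∉x = filter-all _ (All.map ≢-sym (¬Any⇒All¬ x l∉x))

  walk-removeLoop : ∀ {w} x → Walk G w x → Walk G w (removeLoop x)
  walk-removeLoop []       tt           = tt
  walk-removeLoop (e ∷ es) (refl , walk) with e ≟ l
  ... | yes refl = subst (λ z → Walk G z (removeLoop es)) (trans tgt-l (sym src-l))
                         (walk-removeLoop es walk)
  ... | no _     = refl , walk-removeLoop es walk

  walk-spliceLoopAt : ∀ w y → Walk G w y → Walk G w (spliceLoopAt w y)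
  walk-spliceLoopAt w y walk with w ≟ v
  ... | yes refl = src-l , subst (λ z → Walk G z y) (sym tgt-l) walk
  walk-spliceLoopAt w []       tt           | no _ = tt
  walk-spliceLoopAt w (e ∷ es) (refl , walk) | no _ = refl , walk-spliceLoopAt (tgt G e) es walk

  ∈-spliceLoopAt⁺ : ∀ {e} w y → e ∈ y → e ∈ spliceLoopAt w y
  ∈-spliceLoopAt⁺ w y e∈y with w ≟ v
  ... | yes _ = there e∈y
  ∈-spliceLoopAt⁺ w (_ ∷ _)  (here refl)  | no _ = here refl
  ∈-spliceLoopAt⁺ w (e ∷ es) (there e∈es) | no _ = there (∈-spliceLoopAt⁺ (tgt G e) es e∈es)

  ∈-spliceLoopAt⁻ : ∀ {e} w y → e ∈ spliceLoopAt w y → e ≡ l ⊎ e ∈ y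
  ∈-spliceLoopAt⁻ w y e∈ with w ≟ v
  ∈-spliceLoopAt⁻ w y (here refl)  | yes _ = inj₁ refl
  ∈-spliceLoopAt⁻ w y (there e∈y)  | yes _ = inj₂ e∈y
  ∈-spliceLoopAt⁻ w (_ ∷ _)  (here refl) | no _ = inj₂ (here refl)
  ∈-spliceLoopAt⁻ w (e ∷ es) (there e∈)  | no _ with ∈-spliceLoopAt⁻ (tgt G e) es e∈
  ... | inj₁ e≡l   = inj₁ e≡l
  ... | inj₂ e∈es  = inj₂ (there e∈es)

  loop∈spliceLoopAt : ∀ w y → w ≡ v ⊎ Any (λ e → tgt G e ≡ v) y → l ∈ spliceLoopAt w y
  loop∈spliceLoopAt w y visits with w ≟ v
  ... | yes _ = here refl
  loop∈spliceLoopAt w y        (inj₁ w≡v)        | no w≢v = ⊥-elim (w≢v w≡v)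
  loop∈spliceLoopAt w (e ∷ es) (inj₂ (here refl)) | no _ = there (loop∈spliceLoopAt _ es (inj₁ refl))
  loop∈spliceLoopAt w (e ∷ es) (inj₂ (there any)) | no _ = there (loop∈spliceLoopAt _ es (inj₂ any))

  unique-spliceLoopAt : ∀ w y → l ∉ y → Unique y → Unique (spliceLoopAt w y)
  unique-spliceLoopAt w y l∉y uniq with w ≟ v
  ... | yes _ = ¬Any⇒All¬ y l∉y ∷ uniq
  unique-spliceLoopAt w []       l∉y uniq           | no _ = uniq
  unique-spliceLoopAt w (e ∷ es) l∉y (e∉es ∷ uniq)  | no _ =
    ¬Any⇒All¬ _ e∉ ∷ unique-spliceLoopAt (tgt G e) es (l∉y ∘ there) uniq
    where
    e∉ : e ∉ spliceLoopAt (tgt G e) es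
    e∉ e∈ with ∈-spliceLoopAt⁻ (tgt G e) es e∈
    ... | inj₁ refl = l∉y (here refl)
    ... | inj₂ e∈es = All¬⇒¬Any e∉es e∈es

  removeLoop-spliceLoopAt : ∀ w y → l ∉ y → removeLoop (spliceLoopAt w y) ≡ y
  removeLoop-spliceLoopAt w y l∉y with w ≟ v
  ... | yes _ = trans (filter-reject ≢-loop? {xs = y} (λ l≢l → l≢l refl)) (removeLoop-id l∉y)
  removeLoop-spliceLoopAt w []       l∉y | no _ = refl
  removeLoop-spliceLoopAt w (e ∷ es) l∉y | no _ with e ≟ l
  ... | yes refl = ⊥-elim (l∉y (here refl))
  ... | no _     = cong (e ∷_) (removeLoop-spliceLoopAt (tgt G e) es (l∉y ∘ there))

  loop∈tail : ∀ {e es} → e ≢ l → l ∈ e ∷ es → l ∈ es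
  loop∈tail e≢l (here l≡e)  = ⊥-elim (e≢l (sym l≡e))
  loop∈tail e≢l (there l∈es) = l∈es

  leave-v-by-loop : ∀ {g gs} → Walk G v (g ∷ gs) → InR (g ∷ gs) → l ∈ g ∷ gs
                  → (∀ f → f ∈ gs → ¬ Entering f) → g ≡ l
  leave-v-by-loop {g} {gs} (sg , walk) inR l∈x noEntry with g ≟ l
  ... | yes g≡l = g≡l
  ... | no g≢l =
    let f , f∈gs , tf , sf = enter-before-leave walk tg≢v l∈gs src-l
    in ⊥-elim (noEntry f f∈gs (inR f (there f∈gs) , tf , sf))
    where
    l∈gs : l ∈ gs
    l∈gs = loop∈tail g≢l l∈x
    tg≢v : tgt G g ≢ v
    tg≢v tg≡v = g≢l (proj₂ loop g (inR g (here refl) , sg , tg≡v))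

  spliceLoopAt-removeLoop : ∀ w x → Walk G w x → Unique x → InR x → l ∈ x
                          → AtMostOneEntering
                          → (w ≡ v → ∀ f → f ∈ x → ¬ Entering f)
                          → spliceLoopAt w (removeLoop x) ≡ x
  spliceLoopAt-removeLoop _ (g ∷ gs) (refl , walk) (g∉gs ∷ uniq) inR l∈x once noEntry
    with src G g ≟ v | g ≟ l
  ... | yes refl | yes refl = cong (l ∷_) (removeLoop-id (All¬⇒¬Any g∉gs))
  ... | yes refl | no g≢l   =
    ⊥-elim (g≢l (leave-v-by-loop (refl , walk) inR l∈x λ f → noEntry refl f ∘ there))
  ... | no sg≢v  | yes refl = ⊥-elim (sg≢v src-l)
  ... | no sg≢v  | no g≢l   =
    cong (g ∷_) (spliceLoopAt-removeLoop (tgt G g) gs walk uniq (λ e → inR e ∘ there)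
                                         (loop∈tail g≢l l∈x) once noReentry)
    where
    noReentry : tgt G g ≡ v → ∀ f → f ∈ gs → ¬ Entering f
    noReentry tg≡v f f∈gs f-enters with once f-enters (inR g (here refl) , tg≡v , sg≢v)
    ... | refl = All¬⇒¬Any g∉gs f∈gs

  trail-removeLoop : ∀ {u x} → EulerianTrailFrom G R u x
                   → EulerianTrailFrom G (RemoveLoop G R l) u (removeLoop x)
  trail-removeLoop {x = x} (walk , uniq , covers , inR) =
    walk-removeLoop x walk ,
    Unique.filter⁺ ≢-loop? uniq ,
    (λ e (Re , e≢l) → ∈-filter⁺ ≢-loop? (covers e Re) e≢l) ,
    (λ e e∈ → let e∈x , e≢l = ∈-filter⁻ ≢-loop? e∈ in inR e e∈x , e≢l)

  trail-spliceLoopAt : ∀ {u y} → (u ≢ v → ∃ Entering)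
                     → EulerianTrailFrom G (RemoveLoop G R l) u y
                     → EulerianTrailFrom G R u (spliceLoopAt u y)
  trail-spliceLoopAt {u} {y} entering (walk , uniq , covers , inR) =
    walk-spliceLoopAt u y walk ,
    unique-spliceLoopAt u y l∉y uniq ,
    covers′ ,
    inR′
    where
    l∉y : l ∉ y
    l∉y l∈y = proj₂ (inR l l∈y) refl
    visits : u ≡ v ⊎ Any (λ e → tgt G e ≡ v) y
    visits with u ≟ v
    ... | yes u≡v = inj₁ u≡v
    ... | no u≢v  =
      let b , Rb , tb , sb = entering u≢v
      in inj₂ (lose (covers b (Rb , λ b≡l → sb (trans (cong (src G) b≡l) src-l))) tb)
    covers′ : ∀ e → R e → e ∈ spliceLoopAt u y
    covers′ e Re with e ≟ l
    ... | yes refl = loop∈spliceLoopAt u y visits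
    ... | no e≢l   = ∈-spliceLoopAt⁺ u y (covers e (Re , e≢l))
    inR′ : ∀ e → e ∈ spliceLoopAt u y → R e
    inR′ e e∈ with ∈-spliceLoopAt⁻ u y e∈
    ... | inj₁ refl = R-l
    ... | inj₂ e∈y  = proj₁ (inR e e∈y)

  removeLoop-bijection : ∀ u → AtMostOneEntering
                       → (u ≡ v → ∀ e → ¬ Entering e) → (u ≢ v → ∃ Entering)
                       → Bijection (EulerianTrailFrom G R u) (EulerianTrailFrom G (RemoveLoop G R l) u)
  removeLoop-bijection u once noEntry entering = record
    { to      = removeLoop
    ; from    = spliceLoopAt u
    ; to-ok   = λ _ → trail-removeLoop
    ; from-ok = λ _ → trail-spliceLoopAt entering
    ; from∘to = λ x (walk , uniq , covers , inR) →
        spliceLoopAt-removeLoop u x walk uniq inR (covers l R-l) once (λ u≡v f _ → noEntry u≡v f)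
    ; to∘from = λ y (_ , _ , _ , inR) →
        removeLoop-spliceLoopAt u y (λ l∈y → proj₂ (inR l l∈y) refl)
    }

rule2-bijection : ∀ G R u v l → Rule2Applies G R u v l
                → Bijection (EulerianTrailFrom G R u) (EulerianTrailFrom G (RemoveLoop G R l) u)
rule2-bijection G R u v l (loop , _ , inj₁ (v≢u , b , b-unique)) =
  removeLoop-bijection u
    (λ e-enters f-enters → trans (proj₂ b-unique _ e-enters) (sym (proj₂ b-unique _ f-enters)))
    (λ u≡v → ⊥-elim (v≢u (sym u≡v)))
    (λ _ → b , proj₁ b-unique)
  where open LoopRemoval G R v l loop
rule2-bijection G R u v l (loop , _ , inj₂ (refl , noEntry)) =
  removeLoop-bijection u
    (λ e-enters → ⊥-elim (noEntry _ e-enters))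
    (λ _ → noEntry)
    (λ u≢u → ⊥-elim (u≢u refl))
  where open LoopRemoval G R v l loop

mainTheorem8 : (G : Digraph) → WeaklyConnected G → HasEulerianTrail G
    → (v0 : Node G) → IsSource G v0
    → (P : List (Edge G)) → IsState G v0 P
    → (v : Node G) (l : Edge G)
    → Rule2Applies G (Remaining G P) (lastNode G v0 P) v l
    → Bijection (EulerianTrailFrom G (Remaining G P) (lastNode G v0 P))
                (EulerianTrailFrom G (RemoveLoop G (Remaining G P) l) (lastNode G v0 P))
mainTheorem8 G _ _ v0 _ P _ v l = rule2-bijection G (Remaining G P) (lastNode G v0 P) v l
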